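{- For integers $n\ge 0$ and $m\ge 1$, $\chi_{la}(Sp(2n+1,\,2m+1,\,2m+1))=4$.
   Context: All graphs are finite, simple and connected. For a graph $G=(V,E)$ with $q=|E|$ edges, a local antimagic labeling of $G$ is a bijection $f:E\to\{1,\dots,q\}$ such that $f^+(x)\ne f^+(y)$ for every pair of adjacent vertices $x,y$, where $f^+(x)=\sum_{e\ni x} f(e)$. The local antimagic chromatic number $\chi_{la}(G)$ is the minimum, over all local antimagic labelings $f$ of $G$, of the number of distinct values taken by $f^+$. For integers $y_1,y_2,y_3\ge 1$, the spider $Sp(y_1,y_2,y_3)$ is the tree obtained from three paths of lengths (numbers of edges) $y_1,y_2,y_3$ by identifying one end-vertex of each path into a single vertex (the core). -}

module Defs where

open import Data.Nat using (ℕ; zero; suc; _+_; _≤_; _≡ᵇ_; _≟_)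
open import Data.Bool using (Bool; true; false; if_then_else_; _∨_)
open import Data.Product using (Σ; _×_; _,_; proj₁; proj₂)
open import Data.Nat.ListAction using (sum)
open import Data.List using (List; []; _∷_; _++_; length; map; upTo; allFin; lookup; deduplicate)
open import Data.Fin using (Fin; toℕ)
open import Data.Fin.Permutation using (Permutation′; _⟨$⟩ʳ_)
open import Relation.Binary.PropositionalEquality using (_≡_; _≢_)

-- A finite graph: vertices are 0 , 1 , ... , nV - 1 and edges is the
-- list of its edges, each given by its two end-vertices.
record Graph : Set where
  field
    nV    : ℕ
    edges : List (ℕ × ℕ)

open Graph public

nE : Graph → ℕ
nE G = length (edges G)

edge : (G : Graph) → Fin (nE G) → ℕ × ℕ
edge G e = lookup (edges G) e

-- A labeling is a bijection  E → {1,…,q};  we represent it by a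
-- permutation π of Fin q, edge e receiving label  1 + π(e).
Labeling : Graph → Set
Labeling G = Permutation′ (nE G)

label : (G : Graph) → Labeling G → Fin (nE G) → ℕ
label G f e = suc (toℕ (f ⟨$⟩ʳ e))

incident : ℕ → ℕ × ℕ → Bool
incident x (u , v) = (x ≡ᵇ u) ∨ (x ≡ᵇ v)

vsum : (G : Graph) → Labeling G → ℕ → ℕ
vsum G f x =
  sum (map (λ e → if incident x (edge G e) then label G f e else 0) (allFin (nE G)))

IsLocalAntimagic : (G : Graph) → Labeling G → Set
IsLocalAntimagic G f =
  (e : Fin (nE G)) → vsum G f (proj₁ (edge G e)) ≢ vsum G f (proj₂ (edge G e))

numColors : (G : Graph) → Labeling G → ℕ
numColors G f = length (deduplicate _≟_ (map (vsum G f) (upTo (nV G))))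

χla≡ : Graph → ℕ → Set
χla≡ G k =
  (Σ (Labeling G) λ f → IsLocalAntimagic G f × numColors G f ≡ k)
  × ((f : Labeling G) → IsLocalAntimagic G f → k ≤ numColors G f)

-- a path leg of length l attached to the core 0, using vertices o+1 … o+l:
-- edges  0 — o+1 , o+1 — o+2 , … , o+l-1 — o+l
legFrom : ℕ → ℕ → ℕ → List (ℕ × ℕ)
legFrom o prev zero    = []
legFrom o prev (suc l) = (prev , suc o) ∷ legFrom (suc o) (suc o) l

leg : ℕ → ℕ → List (ℕ × ℕ)
leg o l = legFrom o 0 l

-- spider Sp(a,b,c): core 0, legs on vertices 1..a, a+1..a+b, a+b+1..a+b+c
Spider : ℕ → ℕ → ℕ → Graph
Spider a b c = record
  { nV    = suc (a + b + c)
  ; edges = leg 0 a ++ leg a b ++ leg (a + b) c }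

-- Write q = 2n + 4m + 7 for the number of edges and D = q − 1.
--
-- Lower bound (for every labeling, local antimagic or not): the three leaves carry the
-- labels of three distinct edges, hence three distinct values at most q, while the
-- non-leaf end of the edge labelled q has a value larger than q.
--
-- Upper bound: list the edges of each leg from its leaf towards the core, leaving out the
-- pendant edge of the third leg, and label these D edges D, 1, D − 1, 2, … in order; the
-- omitted edge gets q. Two consecutive edges of a leg then sum to D or D + 1, the leaves
-- get D, n + 1 and D + 1, and the core and the neighbour of the third leaf both get the
-- same value C > D + 1. Neighbours away from the core always differ because labels are
-- distinct and positive, and the core exceeds all its neighbours, so the labeling is local
-- antimagic with exactly the four values D, D + 1, n + 1 and C.

module Submission where

open import Defs
open import Algebra.Properties.CommutativeSemigroup using (interchange)
open import Data.Bool using (Bool; true; false; not; if_then_else_)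
open import Data.Fin using (Fin; toℕ; fromℕ<)
open import Data.Fin.Permutation using (Permutation′; permutation; _⟨$⟩ʳ_; _⟨$⟩ˡ_; inverseˡ; inverseʳ)
open import Data.Fin.Properties using (toℕ<n; fromℕ<-toℕ; toℕ-fromℕ<; toℕ-injective)
open import Data.List using (List; []; _∷_; _++_; length; map; upTo; applyUpTo; tabulate; lookup)
open import Data.List.Membership.Propositional using (_∈_)
open import Data.List.Membership.Propositional.Properties
  using (∈-++⁺ˡ; ∈-map⁺; ∈-map⁻; ∈-upTo⁺; ∈-upTo⁻; ∈-deduplicate⁺; ∈-deduplicate⁻)
open import Data.List.Properties using (length-map; length-removeAt′; map-tabulate; length-applyUpTo)
open import Data.List.Relation.Binary.Subset.Propositional using (_⊆_)
open import Data.List.Relation.Unary.All as All using (All; []; _∷_)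
open import Data.List.Relation.Unary.AllPairs using ([]; _∷_)
open import Data.List.Relation.Unary.Any using (here; there; _─_; index)
open import Data.List.Relation.Unary.Unique.Propositional using (Unique)
open import Data.Nat
  using (ℕ; zero; suc; _+_; _*_; _∸_; _≤_; _<_; z≤n; s≤s; z<s; s<s; s≤s⁻¹; _≡ᵇ_; _≟_; _<?_; ⌊_/2⌋)
open import Data.Nat.ListAction using (sum)
open import Data.Nat.ListAction.Properties using (sum-++)
open import Data.Nat.Properties
open import Data.Nat.Solver using (module +-*-Solver)
open import Data.List.Relation.Unary.Unique.DecPropositional.Properties _≟_ using (deduplicate-!)
open import Data.Product using (∃-syntax; _×_; _,_)
open import Data.Sum using (_⊎_; inj₁; inj₂; [_,_]′; map₂)
open import Function using (_∘_)
open import Relation.Binary.PropositionalEquality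
open import Relation.Nullary using (Dec; yes; no; does; ¬_; contradiction)
open import Relation.Nullary.Decidable using (dec-true; dec-false; _⊎-dec_)

applyUpTo-++ : ∀ {A : Set} (h : ℕ → A) m n →
  applyUpTo h m ++ applyUpTo (λ j → h (m + j)) n ≡ applyUpTo h (m + n)
applyUpTo-++ h zero    n = refl
applyUpTo-++ h (suc m) n = cong (h 0 ∷_) (applyUpTo-++ (h ∘ suc) m n)

applyUpTo-cong : ∀ {A : Set} n {g h : ℕ → A} → (∀ {j} → j < n → g j ≡ h j) →
  applyUpTo g n ≡ applyUpTo h n
applyUpTo-cong zero    eq = refl
applyUpTo-cong (suc n) eq = cong₂ _∷_ (eq z<s) (applyUpTo-cong n (eq ∘ s<s))

≡applyUpTo⇒lookup : ∀ {A : Set} {n} (xs : List A) {g : ℕ → A} → xs ≡ applyUpTo g n →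
  ∀ i → lookup xs i ≡ g (toℕ i)
≡applyUpTo⇒lookup {n = suc n} (x ∷ xs) refl Fin.zero    = refl
≡applyUpTo⇒lookup {n = suc n} (x ∷ xs) refl (Fin.suc i) = ≡applyUpTo⇒lookup xs refl i

∑ : ℕ → (ℕ → ℕ) → ℕ
∑ n h = sum (applyUpTo h n)

∑-cong : ∀ n {g h : ℕ → ℕ} → (∀ {k} → k < n → g k ≡ h k) → ∑ n g ≡ ∑ n h
∑-cong zero    eq = refl
∑-cong (suc n) eq = cong₂ _+_ (eq z<s) (∑-cong n (eq ∘ s<s))

∑-zero : ∀ n {h : ℕ → ℕ} → (∀ {k} → k < n → h k ≡ 0) → ∑ n h ≡ 0
∑-zero zero    eq = refl
∑-zero (suc n) eq = cong₂ _+_ (eq z<s) (∑-zero n (eq ∘ s<s))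

∑-distrib-+ : ∀ n (g h : ℕ → ℕ) → ∑ n (λ k → g k + h k) ≡ ∑ n g + ∑ n h
∑-distrib-+ zero    g h = refl
∑-distrib-+ (suc n) g h = trans (cong (g 0 + h 0 +_) (∑-distrib-+ n (g ∘ suc) (h ∘ suc)))
  (interchange +-commutativeSemigroup (g 0) (h 0) (∑ n (g ∘ suc)) (∑ n (h ∘ suc)))

∑-++ : ∀ m n (h : ℕ → ℕ) → ∑ (m + n) h ≡ ∑ m h + ∑ n (λ j → h (m + j))
∑-++ m n h = trans (cong sum (sym (applyUpTo-++ h m n))) (sum-++ (applyUpTo h m) _)

≡ᵇ-≡ : ∀ {m n} → m ≡ n → (m ≡ᵇ n) ≡ true
≡ᵇ-≡ {m} {n} = dec-true (m ≟ n)

≡ᵇ-≢ : ∀ {m n} → m ≢ n → (m ≡ᵇ n) ≡ false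
≡ᵇ-≢ {m} {n} = dec-false (m ≟ n)

δ : ℕ → (ℕ → ℕ) → ℕ → ℕ
δ x g k = if x ≡ᵇ k then g k else 0

∑-δ : ∀ {n x} (g : ℕ → ℕ) → x < n → ∑ n (δ x g) ≡ g x
∑-δ {suc n} {zero}  g _         = trans (cong (g 0 +_) (∑-zero n (λ _ → refl))) (+-identityʳ (g 0))
∑-δ {suc n} {suc x} g (s<s x<n) = ∑-δ (g ∘ suc) x<n

sum-tabulate : ∀ {n} (g : Fin n → ℕ) (h : ℕ → ℕ) → (∀ i → g i ≡ h (toℕ i)) →
  sum (tabulate g) ≡ ∑ n h
sum-tabulate {zero}  g h eq = refl
sum-tabulate {suc n} g h eq = cong₂ _+_ (eq Fin.zero) (sum-tabulate (g ∘ Fin.suc) (h ∘ suc) (eq ∘ Fin.suc))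

∈-─ : ∀ {A : Set} {x z : A} {ys} (x∈ys : x ∈ ys) → z ∈ ys → z ≢ x → z ∈ (ys ─ x∈ys)
∈-─ (here refl)  (here refl) z≢x = contradiction refl z≢x
∈-─ (here refl)  (there z∈)  _   = z∈
∈-─ (there x∈ys) (here refl) _   = here refl
∈-─ (there x∈ys) (there z∈)  z≢x = there (∈-─ x∈ys z∈ z≢x)

Unique-⊆⇒length-≤ : ∀ {A : Set} {xs ys : List A} → Unique xs → xs ⊆ ys → length xs ≤ length ys
Unique-⊆⇒length-≤ {xs = []}     _               _     = z≤n
Unique-⊆⇒length-≤ {xs = x ∷ xs} {ys} (x∉xs ∷ unique) xs⊆ys =
  subst (suc (length xs) ≤_) (sym (length-removeAt′ ys (index x∈ys)))
    (s≤s (Unique-⊆⇒length-≤ unique λ z∈xs →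
      ∈-─ x∈ys (xs⊆ys (there z∈xs)) (≢-sym (All.lookup x∉xs z∈xs))))
  where
  x∈ys : x ∈ ys
  x∈ys = xs⊆ys (here refl)

module EdgeLabels (G : Graph) (f : Labeling G) where

  ℓ : ℕ → ℕ
  ℓ k with k <? nE G
  ... | yes k<q = label G f (fromℕ< k<q)
  ... | no  _   = 0

  ℓ-< : ∀ {k} (k<q : k < nE G) → ℓ k ≡ suc (toℕ (f ⟨$⟩ʳ fromℕ< k<q))
  ℓ-< {k} k<q with k <? nE G
  ... | yes _   = refl
  ... | no  k≮q = contradiction k<q k≮q

  ℓ-toℕ : ∀ i → ℓ (toℕ i) ≡ label G f i
  ℓ-toℕ i = trans (ℓ-< (toℕ<n i)) (cong (λ j → suc (toℕ (f ⟨$⟩ʳ j))) (fromℕ<-toℕ i (toℕ<n i)))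

  ℓ-positive : ∀ {k} → k < nE G → 0 < ℓ k
  ℓ-positive k<q rewrite ℓ-< k<q = z<s

  ℓ-≤ : ∀ {k} → k < nE G → ℓ k ≤ nE G
  ℓ-≤ k<q rewrite ℓ-< k<q = toℕ<n _

  ℓ-injective : ∀ {j k} → j < nE G → k < nE G → ℓ j ≡ ℓ k → j ≡ k
  ℓ-injective {j} {k} j<q k<q ℓj≡ℓk = begin
    j                 ≡⟨ toℕ-fromℕ< j<q ⟨
    toℕ (fromℕ< j<q)  ≡⟨ cong toℕ indices≡ ⟩
    toℕ (fromℕ< k<q)  ≡⟨ toℕ-fromℕ< k<q ⟩
    k                 ∎
    where
    open ≡-Reasoning
    images≡ : f ⟨$⟩ʳ fromℕ< j<q ≡ f ⟨$⟩ʳ fromℕ< k<q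
    images≡ = toℕ-injective (suc-injective (trans (sym (ℓ-< j<q)) (trans ℓj≡ℓk (ℓ-< k<q))))
    indices≡ : fromℕ< j<q ≡ fromℕ< k<q
    indices≡ = trans (sym (inverseˡ f)) (trans (cong (f ⟨$⟩ˡ_) images≡) (inverseˡ f))

  ℓ-surjective : ∀ {v} → v < nE G → ∃[ k ] k < nE G × ℓ k ≡ suc v
  ℓ-surjective {v} v<q = toℕ k , toℕ<n k , (begin
      ℓ (toℕ k)                 ≡⟨ ℓ-toℕ k ⟩
      suc (toℕ (f ⟨$⟩ʳ k))       ≡⟨ cong (suc ∘ toℕ) (inverseʳ f) ⟩
      suc (toℕ (fromℕ< v<q))     ≡⟨ cong suc (toℕ-fromℕ< v<q) ⟩
      suc v                     ∎)
    where
    open ≡-Reasoning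
    k : Fin (nE G)
    k = f ⟨$⟩ˡ fromℕ< v<q

record InverseOn (q : ℕ) (σ ρ : ℕ → ℕ) : Set where
  field
    σ-< : ∀ {k} → k < q → σ k < q
    ρ-< : ∀ {k} → k < q → ρ k < q
    ρ∘σ : ∀ {k} → k < q → ρ (σ k) ≡ k
    σ∘ρ : ∀ {k} → k < q → σ (ρ k) ≡ k

involution⇒InverseOn : ∀ {q} {π : ℕ → ℕ} →
  (∀ {k} → k < q → π k < q) → (∀ {k} → k < q → π (π k) ≡ k) → InverseOn q π π
involution⇒InverseOn π-< π∘π = record { σ-< = π-< ; ρ-< = π-< ; ρ∘σ = π∘π ; σ∘ρ = π∘π }

InverseOn-∘ : ∀ {q σ ρ σ′ ρ′} →
  InverseOn q σ ρ → InverseOn q σ′ ρ′ → InverseOn q (σ′ ∘ σ) (ρ ∘ ρ′)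
InverseOn-∘ {σ = σ} {ρ} {σ′} {ρ′} inv inv′ = record
  { σ-< = I′.σ-< ∘ I.σ-<
  ; ρ-< = I.ρ-< ∘ I′.ρ-<
  ; ρ∘σ = λ k<q → trans (cong ρ (I′.ρ∘σ (I.σ-< k<q))) (I.ρ∘σ k<q)
  ; σ∘ρ = λ k<q → trans (cong σ′ (I.σ∘ρ (I′.ρ-< k<q))) (I′.σ∘ρ k<q)
  }
  where
  module I = InverseOn inv
  module I′ = InverseOn inv′

extendFixing : ℕ → (ℕ → ℕ) → ℕ → ℕ
extendFixing q σ k = if does (k <? q) then σ k else q

extendFixing-< : ∀ {q k} σ → k < q → extendFixing q σ k ≡ σ k
extendFixing-< {q} {k} σ k<q rewrite dec-true (k <? q) k<q = refl

extendFixing-top : ∀ q σ → extendFixing q σ q ≡ q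
extendFixing-top q σ rewrite dec-false (q <? q) (<-irrefl refl) = refl

InverseOn-extendFixing : ∀ {q σ ρ} → InverseOn q σ ρ → InverseOn (suc q) (extendFixing q σ) (extendFixing q ρ)
InverseOn-extendFixing {q} {σ} {ρ} inv = record
  { σ-< = maps σ σ-<
  ; ρ-< = maps ρ ρ-<
  ; ρ∘σ = cancels σ ρ σ-< ρ∘σ
  ; σ∘ρ = cancels ρ σ ρ-< σ∘ρ
  }
  where
  open InverseOn inv
  maps : ∀ h → (∀ {k} → k < q → h k < q) → ∀ {k} → k < suc q → extendFixing q h k < suc q
  maps h h-< k<1+q with m<1+n⇒m<n∨m≡n k<1+q
  ... | inj₁ k<q  rewrite extendFixing-< h k<q = m<n⇒m<1+n (h-< k<q)
  ... | inj₂ refl rewrite extendFixing-top q h = n<1+n q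
  cancels : ∀ h h′ → (∀ {k} → k < q → h k < q) → (∀ {k} → k < q → h′ (h k) ≡ k) →
    ∀ {k} → k < suc q → extendFixing q h′ (extendFixing q h k) ≡ k
  cancels h h′ h-< h′∘h k<1+q with m<1+n⇒m<n∨m≡n k<1+q
  ... | inj₁ k<q  rewrite extendFixing-< h k<q | extendFixing-< h′ (h-< k<q) = h′∘h k<q
  ... | inj₂ refl rewrite extendFixing-top q h = extendFixing-top q h′

module _ {q σ ρ} (inv : InverseOn q σ ρ) where
  open InverseOn inv

  private
    onFin : (h : ℕ → ℕ) → (∀ {k} → k < q → h k < q) → Fin q → Fin q
    onFin h h-< i = fromℕ< (h-< (toℕ<n i))

    onFin-toℕ : ∀ h (h-< : ∀ {k} → k < q → h k < q) i → toℕ (onFin h h-< i) ≡ h (toℕ i)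
    onFin-toℕ h h-< i = toℕ-fromℕ< (h-< (toℕ<n i))

  toPermutation : Permutation′ q
  toPermutation = permutation (onFin σ σ-<) (onFin ρ ρ-<)
    (λ i → toℕ-injective (trans (onFin-toℕ σ σ-< _) (trans (cong σ (onFin-toℕ ρ ρ-< i)) (σ∘ρ (toℕ<n i)))))
    (λ i → toℕ-injective (trans (onFin-toℕ ρ ρ-< _) (trans (cong ρ (onFin-toℕ σ σ-< i)) (ρ∘σ (toℕ<n i)))))

  toPermutation-toℕ : ∀ i → toℕ (toPermutation ⟨$⟩ʳ i) ≡ σ (toℕ i)
  toPermutation-toℕ = onFin-toℕ σ σ-<

module _ (G : Graph) {σ ρ} (inv : InverseOn (nE G) σ ρ) where
  open EdgeLabels G (toPermutation inv)

  ℓ-toPermutation : ∀ {k} → k < nE G → ℓ k ≡ suc (σ k)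
  ℓ-toPermutation k<q = trans (ℓ-< k<q) (cong suc (trans (toPermutation-toℕ inv _) (cong σ (toℕ-fromℕ< k<q))))

module _ (G : Graph) (f : Labeling G) where
  open EdgeLabels G f

  vsum-∑ : ∀ {e : ℕ → ℕ × ℕ} → (∀ i → edge G i ≡ e (toℕ i)) →
    ∀ x → vsum G f x ≡ ∑ (nE G) (λ k → if incident x (e k) then ℓ k else 0)
  vsum-∑ {e} edge≡e x = trans (cong sum (map-tabulate (λ i → i) term))
    (sum-tabulate term _ λ i → cong₂ (λ uv l → if incident x uv then l else 0) (edge≡e i) (sym (ℓ-toℕ i)))
    where
    term : Fin (nE G) → ℕ
    term i = if incident x (edge G i) then label G f i else 0

  private
    values : List ℕ
    values = map (vsum G f) (upTo (nV G))

  numColors-≤ : ∀ cs → (∀ {x} → x < nV G → vsum G f x ∈ cs) → numColors G f ≤ length cs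
  numColors-≤ cs vsum∈cs = Unique-⊆⇒length-≤ (deduplicate-! values) λ v∈ →
    let x , x∈ , v≡ = ∈-map⁻ (vsum G f) (∈-deduplicate⁻ _≟_ values v∈) in
    subst (_∈ cs) (sym v≡) (vsum∈cs (∈-upTo⁻ x∈))

  numColors-≥ : ∀ xs → All (_< nV G) xs → Unique (map (vsum G f) xs) → length xs ≤ numColors G f
  numColors-≥ xs xs<nV unique = subst (_≤ numColors G f) (length-map (vsum G f) xs)
    (Unique-⊆⇒length-≤ unique λ v∈ →
      let x , x∈ , v≡ = ∈-map⁻ (vsum G f) v∈ in
      ∈-deduplicate⁺ _≟_ (subst (_∈ values) (sym v≡) (∈-map⁺ (vsum G f) (∈-upTo⁺ (All.lookup xs<nV x∈)))))

-- Spiders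

module SpiderStructure (a b c : ℕ) where

  G : Graph
  G = Spider a b c

  N : ℕ
  N = a + b + c

  LegStart : ℕ → Set
  LegStart k = k ≡ 0 ⊎ k ≡ a ⊎ k ≡ a + b

  legStart? : ∀ k → Dec (LegStart k)
  legStart? k = k ≟ 0 ⊎-dec k ≟ a ⊎-dec k ≟ a + b

  parent : ℕ → ℕ
  parent k = if does (legStart? k) then 0 else k

  parent-start : ∀ {k} → LegStart k → parent k ≡ 0
  parent-start {k} s rewrite dec-true (legStart? k) s = refl

  parent-inner : ∀ {k} → ¬ LegStart k → parent k ≡ k
  parent-inner {k} ¬s rewrite dec-false (legStart? k) ¬s = refl

  spiderEdge : ℕ → ℕ × ℕ
  spiderEdge k = parent k , suc k

  IsLeg : ℕ → ℕ → Set
  IsLeg o l = LegStart o × (∀ {j} → suc j < l → ¬ LegStart (o + suc j))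

  leg₁ : IsLeg 0 a
  leg₁ = inj₁ refl , λ 1+j<a → [ (λ ()) , [ <⇒≢ 1+j<a , <⇒≢ (<-≤-trans 1+j<a (m≤m+n a b)) ]′ ]′

  leg₂ : IsLeg a b
  leg₂ = inj₂ (inj₁ refl) , λ 1+j<b → [ m+1+n≢0 a , [ m+1+n≢m a , <⇒≢ (+-monoʳ-< a 1+j<b) ]′ ]′

  leg₃ : IsLeg (a + b) c
  leg₃ = inj₂ (inj₂ refl) , λ _ →
    [ m+1+n≢0 (a + b) , [ >⇒≢ (≤-<-trans (m≤m+n a b) (m<m+n (a + b) z<s)) , m+1+n≢m (a + b) ]′ ]′

  legFrom-path : ∀ o l → legFrom o o l ≡ applyUpTo (λ j → o + j , suc (o + j)) l
  legFrom-path o zero    = refl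
  legFrom-path o (suc l) = cong₂ _∷_ (cong (λ v → v , suc v) (sym (+-identityʳ o)))
    (trans (legFrom-path (suc o) l) (applyUpTo-cong l λ {j} _ → cong (λ v → v , suc v) (sym (+-suc o j))))

  leg-edges : ∀ {o l} → IsLeg o l → leg o l ≡ applyUpTo (λ j → spiderEdge (o + j)) l
  leg-edges {o} {zero}  _              = refl
  leg-edges {o} {suc l} (start , inner) = cong₂ _∷_ first rest
    where
    first : (0 , suc o) ≡ spiderEdge (o + 0)
    first rewrite +-identityʳ o | parent-start start = refl
    rest : legFrom (suc o) (suc o) l ≡ applyUpTo (λ j → spiderEdge (o + suc j)) l
    rest = trans (legFrom-path (suc o) l) (applyUpTo-cong l λ {j} j<l → sym (cong₂ _,_
      (trans (parent-inner (inner (s<s j<l))) (+-suc o j)) (cong suc (+-suc o j))))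

  spider-edges : edges G ≡ applyUpTo spiderEdge N
  spider-edges = begin
    leg 0 a ++ leg a b ++ leg (a + b) c
      ≡⟨ cong₂ _++_ (leg-edges leg₁) (cong₂ _++_ (leg-edges leg₂) (trans (leg-edges leg₃)
           (applyUpTo-cong c λ {j} _ → cong spiderEdge (+-assoc a b j)))) ⟩
    applyUpTo spiderEdge a ++ applyUpTo (λ j → spiderEdge (a + j)) b ++ applyUpTo (λ j → spiderEdge (a + (b + j))) c
      ≡⟨ cong (applyUpTo spiderEdge a ++_) (applyUpTo-++ (λ j → spiderEdge (a + j)) b c) ⟩
    applyUpTo spiderEdge a ++ applyUpTo (λ j → spiderEdge (a + j)) (b + c)
      ≡⟨ applyUpTo-++ spiderEdge a (b + c) ⟩
    applyUpTo spiderEdge (a + (b + c))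
      ≡⟨ cong (applyUpTo spiderEdge) (+-assoc a b c) ⟨
    applyUpTo spiderEdge N ∎
    where open ≡-Reasoning

  nE≡N : nE G ≡ N
  nE≡N = trans (cong length spider-edges) (length-applyUpTo spiderEdge N)

  edge≡spiderEdge : ∀ i → edge G i ≡ spiderEdge (toℕ i)
  edge≡spiderEdge = ≡applyUpTo⇒lookup (edges G) spider-edges

module SpiderLabeling (a b c : ℕ) (f : Labeling (Spider a b c)) where
  open SpiderStructure a b c
  open EdgeLabels G f

  vsum-split : ∀ x → vsum G f x ≡
    ∑ N (λ k → if x ≡ᵇ parent k then ℓ k else 0) + ∑ N (λ k → if x ≡ᵇ suc k then ℓ k else 0)
  vsum-split x = begin
    vsum G f x
      ≡⟨ vsum-∑ G f edge≡spiderEdge x ⟩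
    ∑ (nE G) (λ k → if incident x (spiderEdge k) then ℓ k else 0)
      ≡⟨ cong (λ q → ∑ q (λ k → if incident x (spiderEdge k) then ℓ k else 0)) nE≡N ⟩
    ∑ N (λ k → if incident x (spiderEdge k) then ℓ k else 0)
      ≡⟨ ∑-cong N (λ {k} _ → separate k) ⟩
    ∑ N (λ k → (if x ≡ᵇ parent k then ℓ k else 0) + (if x ≡ᵇ suc k then ℓ k else 0))
      ≡⟨ ∑-distrib-+ N _ _ ⟩
    ∑ N (λ k → if x ≡ᵇ parent k then ℓ k else 0) + ∑ N (λ k → if x ≡ᵇ suc k then ℓ k else 0) ∎
    where
    open ≡-Reasoning
    parent≤ : ∀ k → parent k ≤ k
    parent≤ k with does (legStart? k)
    ... | true  = z≤n
    ... | false = ≤-refl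
    separate : ∀ k → (if incident x (spiderEdge k) then ℓ k else 0) ≡
      (if x ≡ᵇ parent k then ℓ k else 0) + (if x ≡ᵇ suc k then ℓ k else 0)
    separate k with x ≟ parent k
    ... | no  x≢p rewrite ≡ᵇ-≢ x≢p = refl
    ... | yes x≡p rewrite ≡ᵇ-≡ x≡p | ≡ᵇ-≢ (<⇒≢ (s≤s (≤-trans (≤-reflexive x≡p) (parent≤ k)))) =
      sym (+-identityʳ (ℓ k))

  <N⇒<nE : ∀ {k} → k < N → k < nE G
  <N⇒<nE {k} = subst (k <_) (sym nE≡N)

  ℓ>0 : ∀ {k} → k < N → 0 < ℓ k
  ℓ>0 = ℓ-positive ∘ <N⇒<nE

  ℓ≤N : ∀ {k} → k < N → ℓ k ≤ N
  ℓ≤N {k} k<N = subst (ℓ k ≤_) nE≡N (ℓ-≤ (<N⇒<nE k<N))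

  ∑-leg-core : ∀ {o l} → IsLeg o l → 0 < l →
    ∑ l (λ j → if 0 ≡ᵇ parent (o + j) then ℓ (o + j) else 0) ≡ ℓ o
  ∑-leg-core {o} {suc l} (start , inner) _ = trans (cong₂ _+_ first (∑-zero l rest)) (+-identityʳ (ℓ o))
    where
    first : (if 0 ≡ᵇ parent (o + 0) then ℓ (o + 0) else 0) ≡ ℓ o
    first rewrite +-identityʳ o | parent-start start = refl
    rest : ∀ {j} → j < l → (if 0 ≡ᵇ parent (o + suc j) then ℓ (o + suc j) else 0) ≡ 0
    rest {j} j<l rewrite parent-inner (inner (s<s j<l)) | +-suc o j = refl

  vsum-core : 0 < a → 0 < b → 0 < c → vsum G f 0 ≡ ℓ 0 + ℓ a + ℓ (a + b)
  vsum-core 0<a 0<b 0<c = begin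
    vsum G f 0
      ≡⟨ vsum-split 0 ⟩
    ∑ ((a + b) + c) atCore + ∑ N (λ _ → 0)
      ≡⟨ cong₂ _+_ (∑-++ (a + b) c atCore) (∑-zero N λ _ → refl) ⟩
    ∑ (a + b) atCore + ∑ c (λ j → atCore (a + b + j)) + 0
      ≡⟨ +-identityʳ _ ⟩
    ∑ (a + b) atCore + ∑ c (λ j → atCore (a + b + j))
      ≡⟨ cong (_+ ∑ c (λ j → atCore (a + b + j))) (∑-++ a b atCore) ⟩
    ∑ a atCore + ∑ b (λ j → atCore (a + j)) + ∑ c (λ j → atCore (a + b + j))
      ≡⟨ cong₂ _+_ (cong₂ _+_ (∑-leg-core leg₁ 0<a) (∑-leg-core leg₂ 0<b)) (∑-leg-core leg₃ 0<c) ⟩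
    ℓ 0 + ℓ a + ℓ (a + b) ∎
    where
    open ≡-Reasoning
    atCore : ℕ → ℕ
    atCore k = if 0 ≡ᵇ parent k then ℓ k else 0

  ∑-parent-inner : ∀ {y} → suc y < N → ¬ LegStart (suc y) →
    ∑ N (λ k → if suc y ≡ᵇ parent k then ℓ k else 0) ≡ ℓ (suc y)
  ∑-parent-inner {y} 1+y<N ¬start = trans (∑-cong N λ {k} _ → pointwise k) (∑-δ ℓ 1+y<N)
    where
    pointwise : ∀ k → (if suc y ≡ᵇ parent k then ℓ k else 0) ≡ δ (suc y) ℓ k
    pointwise k with legStart? k
    ... | yes start
      rewrite parent-start start | ≡ᵇ-≢ (λ 1+y≡k → ¬start (subst LegStart (sym 1+y≡k) start)) = refl
    ... | no ¬start′ rewrite parent-inner ¬start′ = refl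

  ∑-parent-leaf : ∀ {y} → LegStart (suc y) ⊎ N ≤ suc y →
    ∑ N (λ k → if suc y ≡ᵇ parent k then ℓ k else 0) ≡ 0
  ∑-parent-leaf {y} leaf = ∑-zero N pointwise
    where
    1+y≢k : ∀ {k} → ¬ LegStart k → k < N → suc y ≢ k
    1+y≢k ¬start k<N refl = [ ¬start , <⇒≱ k<N ]′ leaf
    pointwise : ∀ {k} → k < N → (if suc y ≡ᵇ parent k then ℓ k else 0) ≡ 0
    pointwise {k} k<N with legStart? k
    ... | yes start rewrite parent-start start = refl
    ... | no ¬start rewrite parent-inner ¬start | ≡ᵇ-≢ (1+y≢k ¬start k<N) = refl

  vsum-inner : ∀ {y} → suc y < N → ¬ LegStart (suc y) → vsum G f (suc y) ≡ ℓ (suc y) + ℓ y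
  vsum-inner {y} 1+y<N ¬start =
    trans (vsum-split (suc y)) (cong₂ _+_ (∑-parent-inner 1+y<N ¬start) (∑-δ ℓ (<-trans (n<1+n y) 1+y<N)))

  vsum-leaf : ∀ {y} → y < N → LegStart (suc y) ⊎ suc y ≡ N → vsum G f (suc y) ≡ ℓ y
  vsum-leaf {y} y<N leaf =
    trans (vsum-split (suc y)) (cong₂ _+_ (∑-parent-leaf (map₂ (≤-reflexive ∘ sym) leaf)) (∑-δ ℓ y<N))

  vertex-inner-or-leaf : ∀ {z} → z < N → (suc z < N × ¬ LegStart (suc z)) ⊎ (LegStart (suc z) ⊎ suc z ≡ N)
  vertex-inner-or-leaf {z} z<N with legStart? (suc z) | m≤n⇒m<n∨m≡n z<N
  ... | yes start  | _              = inj₂ (inj₁ start)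
  ... | no  _      | inj₂ 1+z≡N     = inj₂ (inj₂ 1+z≡N)
  ... | no  ¬start | inj₁ 1+z<N     = inj₁ (1+z<N , ¬start)

  vsum-parent-≢ : ∀ {k} → k < N → ¬ LegStart k → vsum G f (parent k) ≢ vsum G f (suc k)
  vsum-parent-≢ {zero}  _     ¬start _ = ¬start (inj₁ refl)
  vsum-parent-≢ {suc y} 1+y<N ¬start eq rewrite parent-inner ¬start | vsum-inner 1+y<N ¬start
    with vertex-inner-or-leaf 1+y<N
  ... | inj₁ (2+y<N , ¬start′) = <⇒≢ (<-trans (n<1+n y) (n<1+n (suc y)))
          (ℓ-injective (<N⇒<nE (<-trans (n<1+n y) 1+y<N)) (<N⇒<nE 2+y<N) (+-cancelˡ-≡ (ℓ (suc y)) _ _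
            (trans eq (trans (vsum-inner 2+y<N ¬start′) (+-comm (ℓ (suc (suc y))) (ℓ (suc y)))))))
  ... | inj₂ leaf = <⇒≢ (ℓ>0 (<-trans (n<1+n y) 1+y<N))
          (sym (+-cancelˡ-≡ (ℓ (suc y)) _ 0 (trans eq (trans (vsum-leaf 1+y<N leaf) (sym (+-identityʳ _))))))

  core-distinct⇒localAntimagic : (∀ {k} → LegStart k → vsum G f 0 ≢ vsum G f (suc k)) → IsLocalAntimagic G f
  core-distinct⇒localAntimagic core≢ e rewrite edge≡spiderEdge e with legStart? (toℕ e)
  ... | yes start rewrite parent-start start = core≢ start
  ... | no  ¬start = vsum-parent-≢ (subst (toℕ e <_) nE≡N (toℕ<n e)) ¬start

-- The lower bound

module LowerBound (a b c : ℕ) (f : Labeling (Spider (suc a) (suc b) (suc c))) where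
  open SpiderStructure (suc a) (suc b) (suc c)
  open SpiderLabeling (suc a) (suc b) (suc c) f
  open EdgeLabels G f

  ℓ-start<vsum-core : ∀ {k} → LegStart k → ℓ k < vsum G f 0
  ℓ-start<vsum-core start rewrite vsum-core z<s z<s z<s with start
  ... | inj₁ refl        =
    <-≤-trans (m<m+n (ℓ 0) (ℓ>0 (s<s (<-≤-trans (m<m+n a z<s) (m≤m+n _ (suc c)))))) (m≤m+n _ _)
  ... | inj₂ (inj₁ refl) = <-≤-trans (m<n+m (ℓ (suc a)) (ℓ>0 z<s)) (m≤m+n _ _)
  ... | inj₂ (inj₂ refl) = m<n+m (ℓ (suc a + suc b)) (<-≤-trans (ℓ>0 z<s) (m≤m+n _ _))

  heavy-inner : ∀ {k} → k < N → ¬ LegStart k → ℓ k ≡ N → ∃[ x ] x < nV G × N < vsum G f x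
  heavy-inner {zero}  _     ¬start _    = contradiction (inj₁ refl) ¬start
  heavy-inner {suc y} 1+y<N ¬start ℓ≡N = suc y , <-trans 1+y<N (n<1+n N) ,
    subst (_< vsum G f (suc y)) ℓ≡N (subst (ℓ (suc y) <_) (sym (vsum-inner 1+y<N ¬start))
      (m<m+n (ℓ (suc y)) (ℓ>0 (<-trans (n<1+n y) 1+y<N))))

  heavy-vertex : ∃[ x ] x < nV G × N < vsum G f x
  heavy-vertex with ℓ-surjective (<N⇒<nE (n<1+n (a + suc b + suc c)))
  ... | k , k<nE , ℓk≡N with legStart? k
  ...   | yes start = 0 , z<s , subst (_< vsum G f 0) ℓk≡N (ℓ-start<vsum-core start)
  ...   | no ¬start = heavy-inner (subst (k <_) nE≡N k<nE) ¬start ℓk≡N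

  numColors-≥4 : 4 ≤ numColors G f
  numColors-≥4 with heavy-vertex
  ... | x , x<nV , N<vx = numColors-≥ G f (suc i₁ ∷ suc i₂ ∷ suc i₃ ∷ x ∷ [])
      (s<s i₁<N ∷ s<s i₂<N ∷ s<s i₃<N ∷ x<nV ∷ [])
      ((leaves-≢ i₁<i₂ i₂<N leaf₁ leaf₂ ∷ leaves-≢ (<-trans i₁<i₂ i₂<i₃) i₃<N leaf₁ leaf₃
          ∷ leaf-≢-heavy i₁<N leaf₁ ∷ [])
       ∷ (leaves-≢ i₂<i₃ i₃<N leaf₂ leaf₃ ∷ leaf-≢-heavy i₂<N leaf₂ ∷ [])
       ∷ (leaf-≢-heavy i₃<N leaf₃ ∷ [])
       ∷ [] ∷ [])
    where
    i₁ i₂ i₃ : ℕ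
    i₁ = a
    i₂ = a + suc b
    i₃ = a + suc b + suc c
    i₁<i₂ : i₁ < i₂
    i₁<i₂ = m<m+n a z<s
    i₂<i₃ : i₂ < i₃
    i₂<i₃ = m<m+n i₂ z<s
    i₃<N : i₃ < N
    i₃<N = n<1+n i₃
    i₂<N : i₂ < N
    i₂<N = <-trans i₂<i₃ i₃<N
    i₁<N : i₁ < N
    i₁<N = <-trans i₁<i₂ i₂<N
    leaf₁ : vsum G f (suc i₁) ≡ ℓ i₁
    leaf₁ = vsum-leaf i₁<N (inj₁ (inj₂ (inj₁ refl)))
    leaf₂ : vsum G f (suc i₂) ≡ ℓ i₂
    leaf₂ = vsum-leaf i₂<N (inj₁ (inj₂ (inj₂ refl)))
    leaf₃ : vsum G f (suc i₃) ≡ ℓ i₃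
    leaf₃ = vsum-leaf i₃<N (inj₂ refl)
    leaves-≢ : ∀ {i j} → i < j → j < N → vsum G f (suc i) ≡ ℓ i → vsum G f (suc j) ≡ ℓ j →
      vsum G f (suc i) ≢ vsum G f (suc j)
    leaves-≢ i<j j<N leafᵢ leafⱼ eq = <⇒≢ i<j
      (ℓ-injective (<N⇒<nE (<-trans i<j j<N)) (<N⇒<nE j<N) (trans (sym leafᵢ) (trans eq leafⱼ)))
    leaf-≢-heavy : ∀ {i} → i < N → vsum G f (suc i) ≡ ℓ i → vsum G f (suc i) ≢ vsum G f x
    leaf-≢-heavy {i} i<N leafᵢ = <⇒≢ (≤-<-trans (subst (_≤ N) (sym leafᵢ) (ℓ≤N i<N)) N<vx)

-- Reversing the legs, and the zigzag labeling of a path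

mirror : ℕ → ℕ → ℕ
mirror l j = l ∸ suc j

mirror-< : ∀ {l j} → j < l → mirror l j < l
mirror-< {suc l} {j} _ = s≤s (m∸n≤m l j)

mirror-involutive : ∀ {l j} → j < l → mirror l (mirror l j) ≡ j
mirror-involutive {suc l} (s≤s j≤l) = m∸[m∸n]≡n j≤l

mirror-suc : ∀ {l j} → suc j < l → mirror l j ≡ suc (mirror l (suc j))
mirror-suc {suc (suc l)} {zero}  _         = refl
mirror-suc {suc l}       {suc j} (s<s 2+j<l) = mirror-suc 2+j<l

data Block (l₁ l₂ l₃ k : ℕ) : Set where
  block₁ : k < l₁ → Block l₁ l₂ l₃ k
  block₂ : ∀ j → j < l₂ → k ≡ l₁ + j → Block l₁ l₂ l₃ k
  block₃ : ∀ j → j < l₃ → k ≡ l₁ + l₂ + j → Block l₁ l₂ l₃ k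

block : ∀ l₁ l₂ l₃ {k} → k < l₁ + l₂ + l₃ → Block l₁ l₂ l₃ k
block l₁ l₂ l₃ {k} k<L with k <? l₁ | k <? l₁ + l₂
... | yes k<l₁ | _          = block₁ k<l₁
... | no  k≮l₁ | yes k<l₁₂  =
  block₂ (k ∸ l₁) (+-cancelˡ-< l₁ _ _ (subst (_< l₁ + l₂) (sym k≡) k<l₁₂)) (sym k≡)
  where
  k≡ : l₁ + (k ∸ l₁) ≡ k
  k≡ = m+[n∸m]≡n (≮⇒≥ k≮l₁)
... | no  _    | no  k≮l₁₂  =
  block₃ (k ∸ (l₁ + l₂)) (+-cancelˡ-< (l₁ + l₂) _ _ (subst (_< l₁ + l₂ + l₃) (sym k≡) k<L)) (sym k≡)
  where
  k≡ : l₁ + l₂ + (k ∸ (l₁ + l₂)) ≡ k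
  k≡ = m+[n∸m]≡n (≮⇒≥ k≮l₁₂)

module LegReversal (l₁ l₂ l₃ : ℕ) where

  L : ℕ
  L = l₁ + l₂ + l₃

  reversal : ℕ → ℕ
  reversal k = if does (k <? l₁) then mirror l₁ k
               else if does (k <? l₁ + l₂) then l₁ + mirror l₂ (k ∸ l₁)
               else l₁ + l₂ + mirror l₃ (k ∸ (l₁ + l₂))

  reversal-₁ : ∀ {j} → j < l₁ → reversal j ≡ mirror l₁ j
  reversal-₁ {j} j<l₁ rewrite dec-true (j <? l₁) j<l₁ = refl

  reversal-₂ : ∀ {j} → j < l₂ → reversal (l₁ + j) ≡ l₁ + mirror l₂ j
  reversal-₂ {j} j<l₂ rewrite dec-false (l₁ + j <? l₁) (≤⇒≯ (m≤m+n l₁ j))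
    | dec-true (l₁ + j <? l₁ + l₂) (+-monoʳ-< l₁ j<l₂) | m+n∸m≡n l₁ j = refl

  reversal-₃ : ∀ {j} → j < l₃ → reversal (l₁ + l₂ + j) ≡ l₁ + l₂ + mirror l₃ j
  reversal-₃ {j} j<l₃
    rewrite dec-false (l₁ + l₂ + j <? l₁) (≤⇒≯ (≤-trans (m≤m+n l₁ l₂) (m≤m+n (l₁ + l₂) j)))
    | dec-false (l₁ + l₂ + j <? l₁ + l₂) (≤⇒≯ (m≤m+n (l₁ + l₂) j)) | m+n∸m≡n (l₁ + l₂) j = refl

  reversal-< : ∀ {k} → k < L → reversal k < L
  reversal-< k<L with block l₁ l₂ l₃ k<L
  ... | block₁ k<l₁ rewrite reversal-₁ k<l₁ =
    <-≤-trans (mirror-< k<l₁) (≤-trans (m≤m+n l₁ l₂) (m≤m+n _ l₃))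
  ... | block₂ j j<l₂ refl rewrite reversal-₂ j<l₂ =
    subst (l₁ + mirror l₂ j <_) (sym (+-assoc l₁ l₂ l₃))
      (+-monoʳ-< l₁ (<-≤-trans (mirror-< j<l₂) (m≤m+n l₂ l₃)))
  ... | block₃ j j<l₃ refl rewrite reversal-₃ j<l₃ = +-monoʳ-< (l₁ + l₂) (mirror-< j<l₃)

  reversal-involutive : ∀ {k} → k < L → reversal (reversal k) ≡ k
  reversal-involutive k<L with block l₁ l₂ l₃ k<L
  ... | block₁ k<l₁ rewrite reversal-₁ k<l₁ | reversal-₁ (mirror-< k<l₁) = mirror-involutive k<l₁
  ... | block₂ j j<l₂ refl rewrite reversal-₂ j<l₂ | reversal-₂ (mirror-< j<l₂) =
    cong (l₁ +_) (mirror-involutive j<l₂)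
  ... | block₃ j j<l₃ refl rewrite reversal-₃ j<l₃ | reversal-₃ (mirror-< j<l₃) =
    cong (l₁ + l₂ +_) (mirror-involutive j<l₃)

  reversal-inverseOn : InverseOn L reversal reversal
  reversal-inverseOn = involution⇒InverseOn reversal-< reversal-involutive

  private
    reversal-suc-in : ∀ o l {k j} → (∀ {i} → i < l → reversal (o + i) ≡ o + mirror l i) →
      suc j < l → suc k ≡ o + suc j → reversal k ≡ suc (reversal (suc k))
    reversal-suc-in o l {k} {j} rev 1+j<l 1+k≡ = begin
      reversal k                  ≡⟨ cong reversal (suc-injective (trans 1+k≡ (+-suc o j))) ⟩
      reversal (o + j)            ≡⟨ rev (<-trans (n<1+n j) 1+j<l) ⟩
      o + mirror l j              ≡⟨ cong (o +_) (mirror-suc 1+j<l) ⟩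
      o + suc (mirror l (suc j))  ≡⟨ +-suc o _ ⟩
      suc (o + mirror l (suc j))  ≡⟨ cong suc (rev 1+j<l) ⟨
      suc (reversal (o + suc j))  ≡⟨ cong (suc ∘ reversal) 1+k≡ ⟨
      suc (reversal (suc k))      ∎
      where open ≡-Reasoning

  reversal-suc : ∀ {k} → suc k < L → suc k ≢ l₁ → suc k ≢ l₁ + l₂ → reversal k ≡ suc (reversal (suc k))
  reversal-suc 1+k<L ≢l₁ ≢l₁₂ with block l₁ l₂ l₃ 1+k<L
  ... | block₁ 1+k<l₁          = reversal-suc-in 0 l₁ reversal-₁ 1+k<l₁ refl
  ... | block₂ zero    _    1+k≡ = contradiction (trans 1+k≡ (+-identityʳ l₁)) ≢l₁
  ... | block₂ (suc j) j<l₂ 1+k≡ = reversal-suc-in l₁ l₂ reversal-₂ j<l₂ 1+k≡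
  ... | block₃ zero    _    1+k≡ = contradiction (trans 1+k≡ (+-identityʳ (l₁ + l₂))) ≢l₁₂
  ... | block₃ (suc j) j<l₃ 1+k≡ = reversal-suc-in (l₁ + l₂) l₃ reversal-₃ j<l₃ 1+k≡

isOdd : ℕ → Bool
isOdd zero    = false
isOdd (suc i) = not (isOdd i)

isOdd-double : ∀ t → isOdd (t + t) ≡ false
isOdd-double zero    = refl
isOdd-double (suc t) rewrite +-suc t t | isOdd-double t = refl

⌊1+n+n/2⌋≡n : ∀ n → ⌊ suc (n + n) /2⌋ ≡ n
⌊1+n+n/2⌋≡n zero    = refl
⌊1+n+n/2⌋≡n (suc n) rewrite +-suc n n = cong suc (⌊1+n+n/2⌋≡n n)

data EvenOdd : ℕ → Set where
  even : ∀ t → EvenOdd (t + t)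
  odd  : ∀ t → EvenOdd (suc (t + t))

evenOdd : ∀ i → EvenOdd i
evenOdd zero = even 0
evenOdd (suc i) with evenOdd i
... | even t = odd t
... | odd  t = subst EvenOdd (cong suc (+-suc t t)) (even (suc t))

double-<-cancel : ∀ {s t} → s + s < t + t → s < t
double-<-cancel s+s<t+t = ≰⇒> λ t≤s → <⇒≱ s+s<t+t (+-mono-≤ t≤s t≤s)

module Zigzag (H : ℕ) where

  D : ℕ
  D = H + H

  -- Positions 0, 1, 2, 3, … get the 0-based labels D − 1, 0, D − 2, 1, …, so the labels of two
  -- consecutive positions add up to D − 1 or D − 2.
  zigzag : ℕ → ℕ
  zigzag i = if isOdd i then ⌊ i /2⌋ else H + mirror H ⌊ i /2⌋

  zigzag-even : ∀ t → zigzag (t + t) ≡ H + mirror H t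
  zigzag-even t rewrite isOdd-double t | sym (n≡⌊n+n/2⌋ t) = refl

  zigzag-odd : ∀ t → zigzag (suc (t + t)) ≡ t
  zigzag-odd t rewrite isOdd-double t | ⌊1+n+n/2⌋≡n t = refl

  unzigzag : ℕ → ℕ
  unzigzag v = if does (v <? H) then suc (v + v) else mirror H (v ∸ H) + mirror H (v ∸ H)

  unzigzag-low : ∀ {v} → v < H → unzigzag v ≡ suc (v + v)
  unzigzag-low {v} v<H rewrite dec-true (v <? H) v<H = refl

  unzigzag-high : ∀ {v} → H ≤ v → unzigzag v ≡ mirror H (v ∸ H) + mirror H (v ∸ H)
  unzigzag-high {v} H≤v rewrite dec-false (v <? H) (≤⇒≯ H≤v) = refl

  ∸H<H : ∀ {v} → v < D → v ∸ H < H
  ∸H<H {v} v<D with v <? H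
  ... | yes v<H = ≤-<-trans (m∸n≤m v H) v<H
  ... | no  v≮H = subst (v ∸ H <_) (m+n∸m≡n H H) (∸-monoˡ-< v<D (≮⇒≥ v≮H))

  zigzag-inverseOn : InverseOn D zigzag unzigzag
  zigzag-inverseOn = record { σ-< = zigzag-< ; ρ-< = unzigzag-< ; ρ∘σ = unzigzag-zigzag ; σ∘ρ = zigzag-unzigzag }
    where
    zigzag-< : ∀ {i} → i < D → zigzag i < D
    zigzag-< {i} i<D with evenOdd i
    ... | even t rewrite zigzag-even t = +-monoʳ-< H (mirror-< (double-<-cancel i<D))
    ... | odd  t rewrite zigzag-odd t  = <-≤-trans (double-<-cancel (<-trans (n<1+n _) i<D)) (m≤m+n H H)

    unzigzag-< : ∀ {v} → v < D → unzigzag v < D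
    unzigzag-< {v} v<D with v <? H
    ... | yes v<H rewrite unzigzag-low v<H = ≤-<-trans (+-monoˡ-≤ v v<H) (+-monoʳ-< H v<H)
    ... | no  v≮H rewrite unzigzag-high (≮⇒≥ v≮H) = +-mono-< (mirror-< (∸H<H v<D)) (mirror-< (∸H<H v<D))

    unzigzag-zigzag : ∀ {i} → i < D → unzigzag (zigzag i) ≡ i
    unzigzag-zigzag {i} i<D with evenOdd i
    ... | even t rewrite zigzag-even t | unzigzag-high (m≤m+n H (mirror H t)) | m+n∸m≡n H (mirror H t) =
      cong (λ s → s + s) (mirror-involutive {H} {t} (double-<-cancel i<D))
    ... | odd  t = trans (cong unzigzag (zigzag-odd t)) (unzigzag-low (double-<-cancel (<-trans (n<1+n _) i<D)))

    zigzag-unzigzag : ∀ {v} → v < D → zigzag (unzigzag v) ≡ v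
    zigzag-unzigzag {v} v<D with v <? H
    ... | yes v<H rewrite unzigzag-low v<H = zigzag-odd v
    ... | no  v≮H
      rewrite unzigzag-high (≮⇒≥ v≮H) | zigzag-even (mirror H (v ∸ H)) | mirror-involutive (∸H<H v<D) =
      m+[n∸m]≡n (≮⇒≥ v≮H)

  zigzag-consecutive : ∀ {i} → suc i < D →
    suc (zigzag i) + suc (zigzag (suc i)) ≡ suc D ⊎ suc (zigzag i) + suc (zigzag (suc i)) ≡ D
  zigzag-consecutive {i} 1+i<D with evenOdd i
  ... | even t rewrite zigzag-even t | zigzag-odd t = inj₁ (begin
    suc (H + mirror H t) + suc t  ≡⟨ cong suc (+-assoc H (mirror H t) (suc t)) ⟩
    suc (H + (mirror H t + suc t)) ≡⟨ cong (λ x → suc (H + x)) (m∸n+n≡m t<H) ⟩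
    suc D                          ∎)
    where
    open ≡-Reasoning
    t<H : t < H
    t<H = double-<-cancel (<-trans (n<1+n _) 1+i<D)
  ... | odd  t = inj₂ (begin
    suc (zigzag (suc (t + t))) + suc (zigzag (suc (suc (t + t))))
      ≡⟨ cong₂ (λ x y → suc x + suc y) (zigzag-odd t) (trans (cong zigzag 2+t+t≡) (zigzag-even (suc t))) ⟩
    suc t + suc (H + mirror H (suc t))
      ≡⟨ solve 3 (λ t H m → (con 1 :+ t) :+ (con 1 :+ (H :+ m)) := H :+ (m :+ (con 2 :+ t)))
           refl t H (mirror H (suc t)) ⟩
    H + (mirror H (suc t) + suc (suc t))
      ≡⟨ cong (H +_) (m∸n+n≡m (double-<-cancel (subst (_< D) 2+t+t≡ 1+i<D))) ⟩
    D ∎)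
    where
    open ≡-Reasoning
    open +-*-Solver
    2+t+t≡ : suc (suc (t + t)) ≡ suc t + suc t
    2+t+t≡ = cong suc (sym (+-suc t t))

-- The labeling of Sp(2n + 1, 2m + 3, 2m + 3)

module Construction (n m : ℕ) where
  open +-*-Solver

  a b b′ H′ H : ℕ
  a  = suc (2 * n)
  b  = suc b′
  b′ = 2 * suc m
  H′ = n + (suc m + suc m)
  H  = suc H′

  open SpiderStructure a b b
  open LegReversal a b b′
    using (reversal; reversal-<; reversal-inverseOn; reversal-₁; reversal-₂; reversal-₃; reversal-suc)
  open Zigzag H

  blocks≡D : a + b + b′ ≡ D
  blocks≡D = solve 2 (λ n m → (con 1 :+ con 2 :* n) :+ (con 1 :+ con 2 :* (con 1 :+ m)) :+ con 2 :* (con 1 :+ m)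
    := (con 1 :+ (n :+ ((con 1 :+ m) :+ (con 1 :+ m)))) :+ (con 1 :+ (n :+ ((con 1 :+ m) :+ (con 1 :+ m))))) refl n m

  N≡1+D : N ≡ suc D
  N≡1+D = trans (+-suc (a + b) b′) (cong suc blocks≡D)

  D<N : D < N
  D<N = subst (D <_) (sym N≡1+D) (n<1+n D)

  a+b<D : a + b < D
  a+b<D = subst (a + b <_) blocks≡D (m<m+n (a + b) z<s)

  a<D : a < D
  a<D = <-trans (m<m+n a z<s) a+b<D

  2n≡n+n : 2 * n ≡ n + n
  2n≡n+n = cong (n +_) (+-identityʳ n)

  -- Edge D is the pendant edge of the third leg; it keeps the largest label.
  labelIndex : ℕ → ℕ
  labelIndex = extendFixing D (zigzag ∘ reversal)

  labelIndex⁻¹ : ℕ → ℕ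
  labelIndex⁻¹ = extendFixing D (reversal ∘ unzigzag)

  labelIndex-inverseOn : InverseOn (nE G) labelIndex labelIndex⁻¹
  labelIndex-inverseOn = subst (λ q → InverseOn q labelIndex labelIndex⁻¹) (sym (trans nE≡N N≡1+D))
    (InverseOn-extendFixing (InverseOn-∘ (subst (λ q → InverseOn q reversal reversal) blocks≡D reversal-inverseOn)
      zigzag-inverseOn))

  f : Labeling G
  f = toPermutation labelIndex-inverseOn

  open EdgeLabels G f
  open SpiderLabeling a b b f

  ℓ-path : ∀ {k} → k < D → ℓ k ≡ suc (zigzag (reversal k))
  ℓ-path k<D = trans (ℓ-toPermutation G labelIndex-inverseOn (<N⇒<nE (<-trans k<D D<N)))
    (cong suc (extendFixing-< (zigzag ∘ reversal) k<D))

  ℓ-D : ℓ D ≡ suc D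
  ℓ-D = trans (ℓ-toPermutation G labelIndex-inverseOn (<N⇒<nE D<N))
    (cong suc (extendFixing-top D (zigzag ∘ reversal)))

  ℓ-0 : ℓ 0 ≡ suc (H + (suc m + suc m))
  ℓ-0 = begin
    ℓ 0                          ≡⟨ ℓ-path (<-trans z<s a<D) ⟩
    suc (zigzag (reversal 0))    ≡⟨ cong (suc ∘ zigzag) (trans (reversal-₁ z<s) 2n≡n+n) ⟩
    suc (zigzag (n + n))         ≡⟨ cong suc (zigzag-even n) ⟩
    suc (H + (H′ ∸ n))           ≡⟨ cong (λ i → suc (H + i)) (m+n∸m≡n n (suc m + suc m)) ⟩
    suc (H + (suc m + suc m))    ∎
    where open ≡-Reasoning

  ℓ-a : ℓ a ≡ suc (n + suc m)
  ℓ-a = begin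
    ℓ a                          ≡⟨ ℓ-path a<D ⟩
    suc (zigzag (reversal a))
      ≡⟨ cong (suc ∘ zigzag) (trans (cong reversal (sym (+-identityʳ a))) (reversal-₂ z<s)) ⟩
    suc (zigzag (a + b′))
      ≡⟨ cong (suc ∘ zigzag) (solve 2 (λ n m → (con 1 :+ con 2 :* n) :+ con 2 :* (con 1 :+ m)
           := con 1 :+ ((n :+ (con 1 :+ m)) :+ (n :+ (con 1 :+ m)))) refl n m) ⟩
    suc (zigzag (suc ((n + suc m) + (n + suc m)))) ≡⟨ cong suc (zigzag-odd (n + suc m)) ⟩
    suc (n + suc m)              ∎
    where open ≡-Reasoning

  ℓ-a+b : ℓ (a + b) ≡ H
  ℓ-a+b = begin
    ℓ (a + b)                    ≡⟨ ℓ-path a+b<D ⟩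
    suc (zigzag (reversal (a + b)))
      ≡⟨ cong (suc ∘ zigzag) (trans (cong reversal (sym (+-identityʳ (a + b)))) (reversal-₃ z<s)) ⟩
    suc (zigzag (a + b + (m + (suc m + 0))))
      ≡⟨ cong (suc ∘ zigzag) (solve 2 (λ n m →
           (con 1 :+ con 2 :* n) :+ (con 1 :+ con 2 :* (con 1 :+ m)) :+ (m :+ ((con 1 :+ m) :+ con 0))
           := con 1 :+ ((n :+ ((con 1 :+ m) :+ (con 1 :+ m))) :+ (n :+ ((con 1 :+ m) :+ (con 1 :+ m))))) refl n m) ⟩
    suc (zigzag (suc (H′ + H′))) ≡⟨ cong suc (zigzag-odd H′) ⟩
    H                            ∎
    where open ≡-Reasoning

  vsum-a : vsum G f a ≡ D
  vsum-a = begin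
    vsum G f (suc (2 * n))           ≡⟨ vsum-leaf 2n<N (inj₁ (inj₂ (inj₁ refl))) ⟩
    ℓ (2 * n)                        ≡⟨ ℓ-path 2n<D ⟩
    suc (zigzag (reversal (2 * n)))
      ≡⟨ cong (suc ∘ zigzag) (trans (reversal-₁ (n<1+n (2 * n))) (n∸n≡0 (2 * n))) ⟩
    suc (H + H′)                     ≡⟨ +-suc H H′ ⟨
    D                                ∎
    where
    open ≡-Reasoning
    2n<D : 2 * n < D
    2n<D = <-trans (n<1+n (2 * n)) a<D
    2n<N : 2 * n < N
    2n<N = <-trans 2n<D D<N

  vsum-a+b : vsum G f (a + b) ≡ suc n
  vsum-a+b = begin
    vsum G f (suc (2 * n + b))
      ≡⟨ vsum-leaf (<-trans (subst (_< D) (sym 2n+b≡) a+b′<D) D<N) (inj₁ (inj₂ (inj₂ refl))) ⟩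
    ℓ (2 * n + b)                      ≡⟨ cong ℓ 2n+b≡ ⟩
    ℓ (a + b′)                         ≡⟨ ℓ-path a+b′<D ⟩
    suc (zigzag (reversal (a + b′)))
      ≡⟨ cong (suc ∘ zigzag)
           (trans (reversal-₂ (n<1+n b′)) (trans (cong (a +_) (n∸n≡0 b′)) (+-identityʳ a))) ⟩
    suc (zigzag (suc (2 * n)))         ≡⟨ cong (λ i → suc (zigzag (suc i))) 2n≡n+n ⟩
    suc (zigzag (suc (n + n)))         ≡⟨ cong suc (zigzag-odd n) ⟩
    suc n                              ∎
    where
    open ≡-Reasoning
    2n+b≡ : 2 * n + b ≡ a + b′
    2n+b≡ = +-suc (2 * n) b′
    a+b′<D : a + b′ < D
    a+b′<D = <-trans (+-monoʳ-< a (n<1+n b′)) a+b<D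

  vsum-N : vsum G f N ≡ suc D
  vsum-N = begin
    vsum G f (suc (2 * n + b + b))    ≡⟨ vsum-leaf (subst (_< N) (sym last≡D) D<N) (inj₂ refl) ⟩
    ℓ (2 * n + b + b)                  ≡⟨ cong ℓ last≡D ⟩
    ℓ D                                ≡⟨ ℓ-D ⟩
    suc D                              ∎
    where
    open ≡-Reasoning
    last≡D : 2 * n + b + b ≡ D
    last≡D = suc-injective N≡1+D

  vsum-D : vsum G f D ≡ suc D + suc (H + m)
  vsum-D = begin
    vsum G f (suc (H′ + H))                ≡⟨ vsum-inner D<N ¬start ⟩
    ℓ D + ℓ (H′ + H)                        ≡⟨ cong₂ _+_ ℓ-D (ℓ-path (n<1+n (H′ + H))) ⟩
    suc D + suc (zigzag (reversal (H′ + H))) ≡⟨ cong (λ i → suc D + suc (zigzag (reversal i))) H′+H≡ ⟩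
    suc D + suc (zigzag (reversal (a + b + r))) ≡⟨ cong (λ i → suc D + suc (zigzag i)) rev≡ ⟩
    suc D + suc (zigzag (a + b))            ≡⟨ cong (λ i → suc D + suc (zigzag i)) a+b≡ ⟩
    suc D + suc (zigzag (t + t))            ≡⟨ cong (λ i → suc D + suc i) (zigzag-even t) ⟩
    suc D + suc (H + (H′ ∸ t))              ≡⟨ cong (λ i → suc D + suc (H + (i ∸ t))) H′≡ ⟩
    suc D + suc (H + (t + m ∸ t))           ≡⟨ cong (λ i → suc D + suc (H + i)) (m+n∸m≡n t m) ⟩
    suc D + suc (H + m)                     ∎
    where
    open ≡-Reasoning
    r t : ℕ
    r = m + (suc m + 0)
    t = n + suc (suc m)
    ¬start : ¬ LegStart D
    ¬start = [ (λ ()) , [ >⇒≢ a<D , >⇒≢ a+b<D ]′ ]′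
    H′+H≡ : H′ + H ≡ a + b + r
    H′+H≡ = solve 2 (λ n m → (n :+ ((con 1 :+ m) :+ (con 1 :+ m))) :+ (con 1 :+ (n :+ ((con 1 :+ m) :+ (con 1 :+ m))))
      := (con 1 :+ con 2 :* n) :+ (con 1 :+ con 2 :* (con 1 :+ m)) :+ (m :+ ((con 1 :+ m) :+ con 0))) refl n m
    rev≡ : reversal (a + b + r) ≡ a + b
    rev≡ = trans (reversal-₃ (n<1+n r)) (trans (cong (a + b +_) (n∸n≡0 r)) (+-identityʳ (a + b)))
    a+b≡ : a + b ≡ t + t
    a+b≡ = solve 2 (λ n m → (con 1 :+ con 2 :* n) :+ (con 1 :+ con 2 :* (con 1 :+ m))
      := (n :+ (con 2 :+ m)) :+ (n :+ (con 2 :+ m))) refl n m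
    H′≡ : H′ ≡ t + m
    H′≡ = solve 2 (λ n m → n :+ ((con 1 :+ m) :+ (con 1 :+ m)) := (n :+ (con 2 :+ m)) :+ m) refl n m

  vsum-0≡vsum-D : vsum G f 0 ≡ vsum G f D
  vsum-0≡vsum-D = begin
    vsum G f 0                                       ≡⟨ vsum-core z<s z<s z<s ⟩
    ℓ 0 + ℓ a + ℓ (a + b)                            ≡⟨ cong₂ _+_ (cong₂ _+_ ℓ-0 ℓ-a) ℓ-a+b ⟩
    suc (H + (suc m + suc m)) + suc (n + suc m) + H
      ≡⟨ solve 2 (λ n m → let h = con 1 :+ (n :+ ((con 1 :+ m) :+ (con 1 :+ m))) in
           (con 1 :+ (h :+ ((con 1 :+ m) :+ (con 1 :+ m)))) :+ (con 1 :+ (n :+ (con 1 :+ m))) :+ h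
           := (con 1 :+ (h :+ h)) :+ (con 1 :+ (h :+ m))) refl n m ⟩
    suc D + suc (H + m)                              ≡⟨ vsum-D ⟨
    vsum G f D                                       ∎
    where open ≡-Reasoning

  vsum-inner-path : ∀ {y} → suc y < D → ¬ LegStart (suc y) → vsum G f (suc y) ∈ D ∷ suc D ∷ []
  vsum-inner-path {y} 1+y<D ¬start =
    [ (λ e → there (here (trans vsum≡ e))) , (λ e → here (trans vsum≡ e)) ]′ (zigzag-consecutive 1+i<D)
    where
    1+y<L : suc y < a + b + b′
    1+y<L = subst (suc y <_) (sym blocks≡D) 1+y<D
    rev-y : reversal y ≡ suc (reversal (suc y))
    rev-y = reversal-suc 1+y<L (λ e → ¬start (inj₂ (inj₁ e))) (λ e → ¬start (inj₂ (inj₂ e)))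
    1+i<D : suc (reversal (suc y)) < D
    1+i<D = subst (_< D) rev-y (subst (reversal y <_) blocks≡D (reversal-< (<-trans (n<1+n y) 1+y<L)))
    vsum≡ : vsum G f (suc y) ≡ suc (zigzag (reversal (suc y))) + suc (zigzag (suc (reversal (suc y))))
    vsum≡ = trans (vsum-inner (<-trans 1+y<D D<N) ¬start)
      (cong₂ _+_ (ℓ-path 1+y<D) (trans (ℓ-path (<-trans (n<1+n y) 1+y<D)) (cong (suc ∘ zigzag) rev-y)))

  vsum-noncentral : ∀ {x} → x < nV G → x ≢ 0 → x ≢ D → vsum G f x ∈ D ∷ suc D ∷ suc n ∷ []
  vsum-noncentral {zero}  _         x≢0 _   = contradiction refl x≢0
  vsum-noncentral {suc y} (s<s y<N) _   x≢D = vsum-suc (legStart? (suc y))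
    where
    vsum-suc : Dec (LegStart (suc y)) → vsum G f (suc y) ∈ D ∷ suc D ∷ suc n ∷ []
    vsum-suc (yes (inj₁ ()))
    vsum-suc (yes (inj₂ (inj₁ 1+y≡a))) = here (trans (cong (vsum G f) 1+y≡a) vsum-a)
    vsum-suc (yes (inj₂ (inj₂ 1+y≡a+b))) = there (there (here (trans (cong (vsum G f) 1+y≡a+b) vsum-a+b)))
    vsum-suc (no ¬start) = [ inner , leaf ]′ (m≤n⇒m<n∨m≡n y<N)
      where
      inner : suc y < N → vsum G f (suc y) ∈ D ∷ suc D ∷ suc n ∷ []
      inner 1+y<N = ∈-++⁺ˡ (vsum-inner-path (≤∧≢⇒< (s≤s⁻¹ (subst (suc y <_) N≡1+D 1+y<N)) x≢D) ¬start)
      leaf : suc y ≡ N → vsum G f (suc y) ∈ D ∷ suc D ∷ suc n ∷ []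
      leaf 1+y≡N = there (here (trans (cong (vsum G f) 1+y≡N) vsum-N))

  C : ℕ
  C = vsum G f 0

  1+D<C : suc D < C
  1+D<C = subst (suc D <_) (sym (trans vsum-0≡vsum-D vsum-D)) (m<m+n (suc D) z<s)

  noncentral<C : ∀ {v} → v ∈ D ∷ suc D ∷ suc n ∷ [] → v < C
  noncentral<C v∈ = ≤-<-trans (noncentral≤1+D v∈) 1+D<C
    where
    noncentral≤1+D : ∀ {v} → v ∈ D ∷ suc D ∷ suc n ∷ [] → v ≤ suc D
    noncentral≤1+D (here v≡D)                 = ≤-trans (≤-reflexive v≡D) (n≤1+n D)
    noncentral≤1+D (there (here v≡1+D))       = ≤-reflexive v≡1+D
    noncentral≤1+D (there (there (here v≡1+n))) =
      ≤-trans (≤-reflexive v≡1+n) (s≤s (<⇒≤ (<-trans (s≤s (m≤m+n n (n + 0))) a<D)))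

  f-localAntimagic : IsLocalAntimagic G f
  f-localAntimagic = core-distinct⇒localAntimagic λ start C≡ →
    <⇒≢ (noncentral<C (vsum-noncentral (s<s (≤-<-trans (start≤a+b start) (<-trans a+b<D D<N))) (λ ())
      (<⇒≢ (≤-<-trans (s≤s (start≤a+b start)) 1+a+b<D)))) (sym C≡)
    where
    start≤a+b : ∀ {k} → LegStart k → k ≤ a + b
    start≤a+b (inj₁ k≡0)        = ≤-trans (≤-reflexive k≡0) z≤n
    start≤a+b (inj₂ (inj₁ k≡a)) = ≤-trans (≤-reflexive k≡a) (m≤m+n a b)
    start≤a+b (inj₂ (inj₂ k≡a+b)) = ≤-reflexive k≡a+b
    1+a+b<D : suc (a + b) < D
    1+a+b<D = subst (suc (suc (a + b)) ≤_) blocks≡D (subst (_≤ a + b + b′) (+-comm (a + b) 2)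
      (+-monoʳ-≤ (a + b) (s≤s (≤-trans (s≤s z≤n) (m≤n+m _ m)))))

  vsum-colours : ∀ {x} → x < nV G → vsum G f x ∈ C ∷ D ∷ suc D ∷ suc n ∷ []
  vsum-colours {x} x<nV = classify (x ≟ 0) (x ≟ D)
    where
    classify : Dec (x ≡ 0) → Dec (x ≡ D) → vsum G f x ∈ C ∷ D ∷ suc D ∷ suc n ∷ []
    classify (yes x≡0) _         = here (cong (vsum G f) x≡0)
    classify (no  _)   (yes x≡D) = here (trans (cong (vsum G f) x≡D) (sym vsum-0≡vsum-D))
    classify (no  x≢0) (no  x≢D) = there (vsum-noncentral x<nV x≢0 x≢D)

  f-numColors : numColors G f ≡ 4
  f-numColors = ≤-antisym (numColors-≤ G f _ vsum-colours) (LowerBound.numColors-≥4 (2 * n) b′ b′ f)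

theorem5p4 : (n m : ℕ) →
    χla≡ (Spider (suc (2 * n)) (suc (2 * suc m)) (suc (2 * suc m))) 4
theorem5p4 n m = (f , f-localAntimagic , f-numColors) , λ g _ → LowerBound.numColors-≥4 (2 * n) b′ b′ g
  where open Construction n m
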